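{- Let $n \ge 3$ and let $S$ be the set of all transpositions in $S_n$. Then $|\mathrm{Aut}(\mathrm{Cay}(S_n,S))| \le 2(n!)^2$.
   Context: For a group $H$ and a subset $S \subseteq H$ with $1 \notin S$ and $S = S^{ -1}$, the Cayley graph $\mathrm{Cay}(H,S)$ is the simple undirected graph with vertex set $H$ and edges $\{h, sh\}$ for $h \in H$, $s \in S$. -}

module Defs where

open import Data.Nat using (ℕ)
open import Data.Fin using (Fin)
open import Data.Fin.Permutation using (Permutation′; _≈_; _∘ₚ_; transpose; _⟨$⟩ʳ_)
open import Data.Product using (Σ; ∃; ∃-syntax; _×_)
open import Data.List using (List)
open import Data.List.Relation.Unary.AllPairs using (AllPairs)
open import Relation.Binary.PropositionalEquality using (_≡_; _≢_)
open import Relation.Nullary using (¬_)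

Sym : ℕ → Set
Sym n = Permutation′ n

-- Group product (s · h)(x) = s (h x).  In the stdlib, (π ∘ₚ ρ) applies π first.
_·_ : ∀ {n} → Sym n → Sym n → Sym n
s · h = h ∘ₚ s

IsTransposition : ∀ {n} → Sym n → Set
IsTransposition {n} s = ∃[ i ] ∃[ j ] (i ≢ j × s ≈ transpose {n} i j)

Adj : ∀ {n} → Sym n → Sym n → Set
Adj {n} g h = ∃[ s ] (IsTransposition {n} s × g ≈ (s · h))

record Aut (n : ℕ) : Set where
  field
    f : Sym n → Sym n
    g : Sym n → Sym n
    f-resp : ∀ {σ τ} → σ ≈ τ → f σ ≈ f τ
    g-resp : ∀ {σ τ} → σ ≈ τ → g σ ≈ g τ
    fg : ∀ σ → f (g σ) ≈ σ
    gf : ∀ σ → g (f σ) ≈ σ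
    adj-pres : ∀ σ τ → Adj σ τ → Adj (f σ) (f τ)
    adj-refl : ∀ σ τ → Adj (f σ) (f τ) → Adj σ τ

_≈ᴬ_ : ∀ {n} → Aut n → Aut n → Set
φ ≈ᴬ ψ = ∀ σ → Aut.f φ σ ≈ Aut.f ψ σ

Distinct : ∀ {n} → List (Aut n) → Set
Distinct = AllPairs (λ φ ψ → ¬ (φ ≈ᴬ ψ))

-- Right translations act transitively on Cay(Sₙ, S), so an automorphism φ is determined by
-- φ(ε) and by the automorphism g ↦ φ(g) · φ(ε)⁻¹, which fixes ε.  An automorphism fixing ε
-- permutes the transpositions (the neighbours of ε) and detects which of them share a point:
-- (u v) and (u w) have the two 3-cycles on {u, v, w} as further common neighbours, whereas
-- disjoint transpositions have only their product.  As a triangle (a b), (a c), (b c) has a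
-- common neighbour besides ε but a star (a b), (a c), (a d) has none, the star of
-- transpositions (0 i) is mapped onto a star (f 0, f i) for an injection f, and (0 1 2) is
-- mapped to one of the two 3-cycles on f 0, f 1, f 2.  If two automorphisms fixing ε share
-- these data, the quotient χ fixes ε, every transposition and a 3-cycle.  Counting common
-- neighbours of 3-cycles shows that χ then fixes every product of two transpositions, so the
-- conjugate of χ by a right translation by a transposition is again of this kind; induction
-- along a factorisation into transpositions gives χ = id.  Hence φ is determined by φ(ε), f
-- and one bit, which gives the bound 2 (n!)².

module Submission where

open import Defs
open import Level using (0ℓ)
open import Algebra.Bundles using (Group)
import Algebra.Properties.Group as GroupProperties
open import Data.Empty using (⊥)
open import Data.Fin using (Fin; zero; suc; punchIn; punchOut; combine; _<_)
open import Data.Fin.Patterns using (0F; 1F; 2F)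
open import Data.Fin.Permutation as Perm using (_⟨$⟩ʳ_; _⟨$⟩ˡ_; transpose; flip)
open import Data.Fin.Permutation.Transposition.List using (TranspositionList; eval; decompose; eval-decompose)
open import Data.Fin.Properties
  using ( _≟_; suc-injective; punchInᵢ≢i; punchIn-injective; punchIn-punchOut; punchOut-injective
        ; combine-injective; pigeonhole)
open import Data.List using (List; []; _∷_; length; lookup)
open import Data.List.Membership.Propositional using (_∈_)
open import Data.List.Membership.Propositional.Properties using (∈-lookup)
open import Data.List.Relation.Unary.All as All using (All; []; _∷_)
open import Data.List.Relation.Unary.AllPairs using (AllPairs; _∷_)
open import Data.List.Relation.Unary.Any using (here; there)
open import Data.Nat using (ℕ; zero; suc; _+_; _*_; _^_; _!; _≤_; s≤s)
open import Data.Nat.Properties using (_≤?_; ≰⇒>)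
open import Data.Product using (∃-syntax; _×_; _,_; proj₁; proj₂)
open import Data.Sum using (_⊎_; inj₁; inj₂; [_,_]′)
open import Function using (id; Injective)
open import Relation.Binary using (IsEquivalence)
import Relation.Binary.Reasoning.Setoid as SetoidReasoning
open import Relation.Binary.PropositionalEquality
open import Relation.Nullary using (¬_; yes; no; contradiction)
open import Relation.Nullary.Decidable using (dec-true; dec-false)

private variable
  n : ℕ
  i j p q p′ q′ u v w a b c d : Fin n
  g h σ τ : Sym n

-- Finite combinatorics

head≢tail : (f : Fin (suc n) → Fin (suc n)) → Injective _≡_ _≡_ f → (i : Fin n) → f zero ≢ f (suc i)
head≢tail f f-injective i eq with f-injective eq
... | ()

punchOut-tail : (f : Fin (suc n) → Fin (suc n)) → Injective _≡_ _≡_ f → Fin n → Fin n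
punchOut-tail f f-injective i = punchOut (head≢tail f f-injective i)

punchOut-tail-injective : (f : Fin (suc n) → Fin (suc n)) (f-injective : Injective _≡_ _≡_ f) →
                          Injective _≡_ _≡_ (punchOut-tail f f-injective)
punchOut-tail-injective f f-injective {i} {j} eq =
  suc-injective (f-injective (punchOut-injective (head≢tail f f-injective i) (head≢tail f f-injective j) eq))

lehmerCode : (f : Fin n → Fin n) → Injective _≡_ _≡_ f → Fin (n !)
lehmerCode {zero} f _ = zero
lehmerCode {suc n} f f-injective =
  combine (f zero) (lehmerCode (punchOut-tail f f-injective) (punchOut-tail-injective f f-injective))

lehmerCode-injective : (f g : Fin n → Fin n)
                       (f-injective : Injective _≡_ _≡_ f) (g-injective : Injective _≡_ _≡_ g) →
                       lehmerCode f f-injective ≡ lehmerCode g g-injective → ∀ x → f x ≡ g x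
lehmerCode-injective {suc n} f g f-inj g-inj eq zero = proj₁ (combine-injective (f zero) _ (g zero) _ eq)
lehmerCode-injective {suc n} f g f-inj g-inj eq (suc x) = begin
  f (suc x)                                ≡⟨ punchIn-punchOut _ ⟨
  punchIn (f zero) (punchOut-tail f f-inj x) ≡⟨ cong₂ punchIn heads-equal (tails-equal x) ⟩
  punchIn (g zero) (punchOut-tail g g-inj x) ≡⟨ punchIn-punchOut _ ⟩
  g (suc x)                                ∎
  where
  open ≡-Reasoning
  heads-equal = proj₁ (combine-injective (f zero) _ (g zero) _ eq)
  tails-equal = lehmerCode-injective (punchOut-tail f f-inj) (punchOut-tail g g-inj)
                  (punchOut-tail-injective f f-inj) (punchOut-tail-injective g g-inj)
                  (proj₂ (combine-injective (f zero) _ (g zero) _ eq))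

AllPairs-lookup : {A : Set} {R : A → A → Set} {xs : List A} → AllPairs R xs →
                  {i j : Fin (length xs)} → i < j → R (lookup xs i) (lookup xs j)
AllPairs-lookup (Rx ∷ _) {zero} {suc j} _ = All.lookup Rx (∈-lookup j)
AllPairs-lookup (_ ∷ pairs) {suc i} {suc j} (s≤s i<j) = AllPairs-lookup pairs i<j

module _ {A : Set} {_∼_ : A → A → Set} where

  distinct-length≤ : {M : ℕ} (key : A → Fin M) → (∀ x y → key x ≡ key y → x ∼ y) →
                     (xs : List A) → AllPairs (λ x y → ¬ x ∼ y) xs → length xs ≤ M
  distinct-length≤ {M} key key-complete xs distinct with length xs ≤? M
  ... | yes length≤M = length≤M
  ... | no length≰M with pigeonhole (≰⇒> length≰M) (λ i → key (lookup xs i))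
  ...   | i , j , i<j , same-key = contradiction (key-complete _ _ same-key) (AllPairs-lookup distinct i<j)

-- m ^ 2 unfolds to m * (m * 1), hence the innermost factor Fin 1.
combine₃ : {l m : ℕ} → Fin l → Fin m → Fin m → Fin (l * m ^ 2)
combine₃ i j k = combine i (combine j (combine k zero))

combine₃-injective : {l m : ℕ} (i : Fin l) (j k : Fin m) (i′ : Fin l) (j′ k′ : Fin m) →
                     combine₃ i j k ≡ combine₃ i′ j′ k′ → i ≡ i′ × j ≡ j′ × k ≡ k′
combine₃-injective i j k i′ j′ k′ eq with combine-injective i _ i′ _ eq
... | i≡i′ , eq′ with combine-injective j _ j′ _ eq′
... | j≡j′ , eq″ = i≡i′ , j≡j′ , proj₁ (combine-injective k zero k′ zero eq″)

fresh-point : {k : ℕ} (a b : Fin (3 + k)) → ∃[ c ] (c ≢ a × c ≢ b)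
fresh-point a b with a ≟ b
... | yes refl = punchIn a zero , punchInᵢ≢i a zero , punchInᵢ≢i a zero
... | no a≢b = punchIn a c′ , punchInᵢ≢i a c′ , λ c≡b →
      punchInᵢ≢i b′ zero (punchIn-injective a c′ b′ (trans c≡b (sym (punchIn-punchOut a≢b))))
  where
  b′ = punchOut a≢b
  c′ = punchIn b′ zero

-- Permutation._≈_, and the predicates IsTransposition and Adj built from it, unfold to Π- and
-- Σ-types from which Agda cannot recover the permutations involved; wrapping the equality in
-- a record keeps them inferable.
infix 4 _≃_
record _≃_ (σ τ : Sym n) : Set where
  constructor mk≃
  field at : σ Perm.≈ τ
open _≃_

≃-isEquivalence : IsEquivalence (_≃_ {n})
≃-isEquivalence = record
  { refl = mk≃ λ _ → refl
  ; sym = λ p → mk≃ λ x → sym (at p x)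
  ; trans = λ p q → mk≃ λ x → trans (at p x) (at q x) }

·-cong : {σ σ′ τ τ′ : Sym n} → σ ≃ σ′ → τ ≃ τ′ → σ · τ ≃ σ′ · τ′
·-cong {σ′ = σ′} p q = mk≃ λ x → trans (at p _) (cong (σ′ ⟨$⟩ʳ_) (at q x))

≡⇒≃ : {σ τ : Sym n} → σ ≡ τ → σ ≃ τ
≡⇒≃ refl = mk≃ λ _ → refl

·-congˡ : (σ : Sym n) {τ τ′ : Sym n} → τ ≃ τ′ → σ · τ ≃ σ · τ′
·-congˡ σ {τ} {τ′} = ·-cong {σ = σ} {σ} {τ} {τ′} (mk≃ λ _ → refl)

·-congʳ : (τ : Sym n) {σ σ′ : Sym n} → σ ≃ σ′ → σ · τ ≃ σ′ · τ
·-congʳ τ {σ} {σ′} p = ·-cong {σ = σ} {σ′} {τ} {τ} p (mk≃ λ _ → refl)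

Sym-group : ℕ → Group 0ℓ 0ℓ
Sym-group n = record
  { Carrier = Sym n ; _≈_ = _≃_ ; _∙_ = _·_ ; ε = Perm.id ; _⁻¹ = flip
  ; isGroup = record
    { isMonoid = record
      { isSemigroup = record
        { isMagma = record { isEquivalence = ≃-isEquivalence ; ∙-cong = ·-cong }
        ; assoc = λ _ _ _ → mk≃ λ _ → refl }
      ; identity = (λ _ → mk≃ λ _ → refl) , (λ _ → mk≃ λ _ → refl) }
    ; inverse = (λ σ → mk≃ λ _ → Perm.inverseˡ σ) , (λ σ → mk≃ λ _ → Perm.inverseʳ σ)
    ; ⁻¹-cong = λ {σ} {τ} p → mk≃ λ x →
        trans (cong (σ ⟨$⟩ˡ_) (trans (sym (Perm.inverseʳ τ)) (sym (at p _)))) (Perm.inverseˡ σ) } }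

open module SymGroup {n} = Group (Sym-group n)
  using (ε; _⁻¹; identityˡ; identityʳ; inverseˡ; inverseʳ; ⁻¹-cong)
  renaming (refl to ≃-refl; sym to ≃-sym; trans to ≃-trans)
open module SymGroupProperties {n} = GroupProperties (Sym-group n) using (∙-cancelʳ)
open module ≃-Reasoning {n} = SetoidReasoning (Group.setoid (Sym-group n))

∈⊎∉ : (x : Fin n) (xs : List (Fin n)) → x ∈ xs ⊎ All (x ≢_) xs
∈⊎∉ x [] = inj₂ []
∈⊎∉ x (y ∷ ys) with x ≟ y | ∈⊎∉ x ys
... | yes x≡y | _ = inj₁ (here x≡y)
... | no _ | inj₁ x∈ys = inj₁ (there x∈ys)
... | no x≢y | inj₂ x∉ys = inj₂ (x≢y ∷ x∉ys)

Agree : Sym n → Sym n → Fin n → Set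
Agree σ τ x = σ ⟨$⟩ʳ x ≡ τ ⟨$⟩ʳ x

≃-onPoints : {σ τ : Sym n} (xs : List (Fin n)) → All (Agree σ τ) xs →
             (∀ x → All (x ≢_) xs → Agree σ τ x) → σ ≃ τ
≃-onPoints xs agree outside = mk≃ λ x → [ All.lookup agree , outside x ]′ (∈⊎∉ x xs)

FixesOutside : Sym n → List (Fin n) → Set
FixesOutside π xs = ∀ x → All (x ≢_) xs → π ⟨$⟩ʳ x ≡ x

moved⇒∈ : (π : Sym n) (xs : List (Fin n)) {x : Fin n} → FixesOutside π xs → π ⟨$⟩ʳ x ≢ x → x ∈ xs
moved⇒∈ π xs {x} fixes moved = [ id , (λ x∉xs → contradiction (fixes x x∉xs) moved) ]′ (∈⊎∉ x xs)

-- Transpositions, 3-cycles and double transpositions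

transpose-fst : (i j : Fin n) → transpose i j ⟨$⟩ʳ i ≡ j
transpose-fst i j rewrite dec-true (i ≟ i) refl = refl

transpose-snd : (i j : Fin n) → transpose i j ⟨$⟩ʳ j ≡ i
transpose-snd i j with j ≟ i
... | yes j≡i = j≡i
... | no _ rewrite dec-true (j ≟ j) refl = refl

transpose-fix : {i j k : Fin n} → k ≢ i → k ≢ j → transpose i j ⟨$⟩ʳ k ≡ k
transpose-fix {i = i} {j} {k} k≢i k≢j rewrite dec-false (k ≟ i) k≢i | dec-false (k ≟ j) k≢j = refl

transpose-same : (i : Fin n) → transpose i i ≃ ε
transpose-same i = ≃-onPoints (i ∷ []) (transpose-fst i i ∷ []) λ { x (x≢i ∷ []) → transpose-fix x≢i x≢i }

transpose-comm : (i j : Fin n) → transpose i j ≃ transpose j i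
transpose-comm i j = ≃-onPoints (i ∷ j ∷ [])
  (trans (transpose-fst i j) (sym (transpose-snd j i)) ∷
   trans (transpose-snd i j) (sym (transpose-fst j i)) ∷ [])
  λ { x (x≢i ∷ x≢j ∷ []) → trans (transpose-fix x≢i x≢j) (sym (transpose-fix x≢j x≢i)) }

transpose-involutive : (i j : Fin n) → transpose i j · transpose i j ≃ ε
transpose-involutive i j = ≃-onPoints (i ∷ j ∷ [])
  (trans (cong (transpose i j ⟨$⟩ʳ_) (transpose-fst i j)) (transpose-snd i j) ∷
   trans (cong (transpose i j ⟨$⟩ʳ_) (transpose-snd i j)) (transpose-fst i j) ∷ [])
  λ { x (x≢i ∷ x≢j ∷ []) →
        trans (cong (transpose i j ⟨$⟩ʳ_) (transpose-fix x≢i x≢j)) (transpose-fix x≢i x≢j) }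

transpose-cancel : {r : Sym n} → r ≃ transpose i j → r · transpose i j ≃ ε
transpose-cancel {i = i} {j} r≃ij = ≃-trans (·-congʳ (transpose i j) r≃ij) (transpose-involutive i j)

Transposition : Sym n → Set
Transposition {n} s = ∃[ i ] ∃[ j ] (i ≢ j × s ≃ transpose {n} i j)

transpose-transposition : i ≢ j → Transposition (transpose i j)
transpose-transposition {i = i} {j} i≢j = i , j , i≢j , ≃-refl

Transposition-resp : {s t : Sym n} → s ≃ t → Transposition s → Transposition t
Transposition-resp s≃t (i , j , i≢j , s≃) = i , j , i≢j , ≃-trans (≃-sym s≃t) s≃

transposition-involutive : {s : Sym n} → Transposition s → s · s ≃ ε
transposition-involutive {s = s} (i , j , _ , s≃) = ≃-trans (·-congˡ s s≃) (transpose-cancel s≃)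

transposition-sending : {r : Sym n} → Transposition r → p ≢ q → r ⟨$⟩ʳ q ≡ p → r ≃ transpose p q
transposition-sending {q = q} (i , j , _ , r≃) p≢q rq≡p with q ≟ i | q ≟ j
... | yes refl | _ with trans (sym rq≡p) (trans (at r≃ q) (transpose-fst q j))
...   | refl = ≃-trans r≃ (transpose-comm q _)
transposition-sending {q = q} (i , j , _ , r≃) p≢q rq≡p | no _ | yes refl
  with trans (sym rq≡p) (trans (at r≃ q) (transpose-snd i q))
...   | refl = r≃
transposition-sending {q = q} (i , j , _ , r≃) p≢q rq≡p | no q≢i | no q≢j =
  contradiction (trans (sym rq≡p) (trans (at r≃ q) (transpose-fix q≢i q≢j))) p≢q

right-factor-moves : {r′ π : Sym n} → Transposition r′ → p ≢ q → r′ · transpose p q ≃ π → ¬ π ≃ ε →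
                     π ⟨$⟩ʳ p ≢ p
right-factor-moves {p = p} {q} {r′} {π} T′ p≢q r′pq≃π π≄ε πp≡p =
  π≄ε (≃-trans (≃-sym r′pq≃π) (transpose-cancel (transposition-sending T′ p≢q r′q≡p)))
  where
  r′q≡p : r′ ⟨$⟩ʳ q ≡ p
  r′q≡p = trans (cong (r′ ⟨$⟩ʳ_) (sym (transpose-fst p q))) (trans (at r′pq≃π p) πp≡p)

involution-no-factor : {r′ π : Sym n} → Transposition r′ → π · π ≃ ε → p ≢ q →
                       π ⟨$⟩ʳ p ≢ p → π ⟨$⟩ʳ p ≢ q → ¬ r′ · transpose p q ≃ π
involution-no-factor {p = p} {q} {r′} {π} T′ ππ≃ε p≢q πp≢p πp≢q r′pq≃π =
  πp≢q (trans (cong (π ⟨$⟩ʳ_) (sym πq≡p)) (at ππ≃ε q))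
  where
  r′q≡πp : r′ ⟨$⟩ʳ q ≡ π ⟨$⟩ʳ p
  r′q≡πp = trans (cong (r′ ⟨$⟩ʳ_) (sym (transpose-fst p q))) (at r′pq≃π p)
  r′≃ : r′ ≃ transpose (π ⟨$⟩ʳ p) q
  r′≃ = transposition-sending T′ πp≢q r′q≡πp
  πq≡p : π ⟨$⟩ʳ q ≡ p
  πq≡p = trans (sym (trans (cong (r′ ⟨$⟩ʳ_) (sym (transpose-snd p q))) (at r′pq≃π q)))
               (trans (at r′≃ p) (transpose-fix (≢-sym πp≢p) p≢q))

pattern 1st = here refl
pattern 2nd = there (here refl)
pattern 3rd = there (there (here refl))
pattern 4th = there (there (there (here refl)))

cycle : Fin n → Fin n → Fin n → Sym n
cycle u v w = transpose u v · transpose v w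

cycle-fixesOutside : (u v w : Fin n) → FixesOutside (cycle u v w) (u ∷ v ∷ w ∷ [])
cycle-fixesOutside u v w x (x≢u ∷ x≢v ∷ x≢w ∷ []) =
  trans (cong (transpose u v ⟨$⟩ʳ_) (transpose-fix x≢v x≢w)) (transpose-fix x≢u x≢v)

cycle-u : u ≢ v → u ≢ w → cycle u v w ⟨$⟩ʳ u ≡ v
cycle-u {u = u} {v} u≢v u≢w = trans (cong (transpose u v ⟨$⟩ʳ_) (transpose-fix u≢v u≢w)) (transpose-fst u v)

cycle-v : u ≢ w → v ≢ w → cycle u v w ⟨$⟩ʳ v ≡ w
cycle-v {u = u} {w} {v} u≢w v≢w =
  trans (cong (transpose u v ⟨$⟩ʳ_) (transpose-fst v w)) (transpose-fix (≢-sym u≢w) (≢-sym v≢w))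

cycle-w : (u v w : Fin n) → cycle u v w ⟨$⟩ʳ w ≡ u
cycle-w u v w = trans (cong (transpose u v ⟨$⟩ʳ_) (transpose-snd v w)) (transpose-snd u v)

cycle≄ε : u ≢ v → u ≢ w → ¬ cycle u v w ≃ ε
cycle≄ε {u = u} u≢v u≢w c≃ε = u≢v (sym (trans (sym (cycle-u u≢v u≢w)) (at c≃ε u)))

cycle-rotate : u ≢ v → v ≢ w → u ≢ w → cycle u v w ≃ cycle v w u
cycle-rotate {u = u} {v} {w} u≢v v≢w u≢w = ≃-onPoints (u ∷ v ∷ w ∷ [])
  (trans (cycle-u u≢v u≢w) (sym (cycle-w v w u)) ∷
   trans (cycle-v u≢w v≢w) (sym (cycle-u v≢w (≢-sym u≢v))) ∷
   trans (cycle-w u v w) (sym (cycle-v (≢-sym u≢v) (≢-sym u≢w))) ∷ [])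
  λ { x (x≢u ∷ x≢v ∷ x≢w ∷ []) →
        trans (cycle-fixesOutside u v w x (x≢u ∷ x≢v ∷ x≢w ∷ []))
              (sym (cycle-fixesOutside v w u x (x≢v ∷ x≢w ∷ x≢u ∷ []))) }

cycle-factor : {r′ r : Sym n} → u ≢ v → v ≢ w → u ≢ w → Transposition r′ → Transposition r →
               r′ · r ≃ cycle u v w → r ≃ transpose u v ⊎ r ≃ transpose v w ⊎ r ≃ transpose u w
cycle-factor {u = u} {v} {w} {r′ = r′} {r} u≢v v≢w u≢w T′ (p , q , p≢q , r≃) r′r≃c =
  within (moved p≢q r′pq≃c) (moved (≢-sym p≢q) r′qp≃c)
  where
  r′pq≃c : r′ · transpose p q ≃ cycle u v w
  r′pq≃c = ≃-trans (·-congˡ r′ (≃-sym r≃)) r′r≃c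
  r′qp≃c : r′ · transpose q p ≃ cycle u v w
  r′qp≃c = ≃-trans (·-congˡ r′ (≃-trans (transpose-comm q p) (≃-sym r≃))) r′r≃c
  moved : {x y : Fin _} → x ≢ y → r′ · transpose x y ≃ cycle u v w → x ∈ u ∷ v ∷ w ∷ []
  moved x≢y H = moved⇒∈ (cycle u v w) (u ∷ v ∷ w ∷ []) (cycle-fixesOutside u v w)
                         (right-factor-moves T′ x≢y H (cycle≄ε u≢v u≢w))
  flipped : r ≃ transpose q p
  flipped = ≃-trans r≃ (transpose-comm p q)
  within : p ∈ u ∷ v ∷ w ∷ [] → q ∈ u ∷ v ∷ w ∷ [] →
           r ≃ transpose u v ⊎ r ≃ transpose v w ⊎ r ≃ transpose u w
  within 1st 1st = contradiction refl p≢q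
  within 1st 2nd = inj₁ r≃
  within 1st 3rd = inj₂ (inj₂ r≃)
  within 2nd 1st = inj₁ flipped
  within 2nd 2nd = contradiction refl p≢q
  within 2nd 3rd = inj₂ (inj₁ r≃)
  within 3rd 1st = inj₂ (inj₂ flipped)
  within 3rd 2nd = inj₂ (inj₁ flipped)
  within 3rd 3rd = contradiction refl p≢q


double-fixesOutside : (a b c d : Fin n) → FixesOutside (transpose a b · transpose c d) (a ∷ b ∷ c ∷ d ∷ [])
double-fixesOutside a b c d x (x≢a ∷ x≢b ∷ x≢c ∷ x≢d ∷ []) =
  trans (cong (transpose a b ⟨$⟩ʳ_) (transpose-fix x≢c x≢d)) (transpose-fix x≢a x≢b)

record Distinct₄ (a b c d : Fin n) : Set where
  field
    a≢b : a ≢ b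
    a≢c : a ≢ c
    a≢d : a ≢ d
    b≢c : b ≢ c
    b≢d : b ≢ d
    c≢d : c ≢ d

Distinct₄-swap : Distinct₄ a b c d → Distinct₄ c d a b
Distinct₄-swap δ = record
  { a≢b = c≢d ; a≢c = ≢-sym a≢c ; a≢d = ≢-sym b≢c
  ; b≢c = ≢-sym a≢d ; b≢d = ≢-sym b≢d ; c≢d = a≢b }
  where open Distinct₄ δ

module DoubleEvaluation {a b c d : Fin n} (δ : Distinct₄ a b c d) where

  open Distinct₄ δ

  private
    π = transpose a b · transpose c d

  double-a : π ⟨$⟩ʳ a ≡ b
  double-a = trans (cong (transpose a b ⟨$⟩ʳ_) (transpose-fix a≢c a≢d)) (transpose-fst a b)

  double-b : π ⟨$⟩ʳ b ≡ a
  double-b = trans (cong (transpose a b ⟨$⟩ʳ_) (transpose-fix b≢c b≢d)) (transpose-snd a b)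

  double-c : π ⟨$⟩ʳ c ≡ d
  double-c = trans (cong (transpose a b ⟨$⟩ʳ_) (transpose-fst c d)) (transpose-fix (≢-sym a≢d) (≢-sym b≢d))

  double-d : π ⟨$⟩ʳ d ≡ c
  double-d = trans (cong (transpose a b ⟨$⟩ʳ_) (transpose-snd c d)) (transpose-fix (≢-sym a≢c) (≢-sym b≢c))

  double≄ε : ¬ π ≃ ε
  double≄ε π≃ε = a≢b (sym (trans (sym double-a) (at π≃ε a)))

open DoubleEvaluation

module _ {a b c d : Fin n} (δ : Distinct₄ a b c d) where

  private
    π = transpose a b · transpose c d

  disjoint-comm : transpose c d · transpose a b ≃ π
  disjoint-comm = ≃-onPoints (a ∷ b ∷ c ∷ d ∷ [])
    (trans (double-c δ′) (sym (double-a δ)) ∷ trans (double-d δ′) (sym (double-b δ)) ∷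
     trans (double-a δ′) (sym (double-c δ)) ∷ trans (double-b δ′) (sym (double-d δ)) ∷ [])
    λ { x (x≢a ∷ x≢b ∷ x≢c ∷ x≢d ∷ []) →
          trans (double-fixesOutside c d a b x (x≢c ∷ x≢d ∷ x≢a ∷ x≢b ∷ []))
                (sym (double-fixesOutside a b c d x (x≢a ∷ x≢b ∷ x≢c ∷ x≢d ∷ []))) }
    where δ′ = Distinct₄-swap δ

  double-involutive : π · π ≃ ε
  double-involutive = begin
    π · π                                ≈⟨ ·-congʳ π (≃-sym disjoint-comm) ⟩
    transpose c d · (transpose a b · π)  ≈⟨ ·-congˡ (transpose c d) (·-congʳ (transpose c d) (transpose-involutive a b)) ⟩
    transpose c d · transpose c d        ≈⟨ transpose-involutive c d ⟩
    ε                                    ∎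

  double-factor : {r′ r : Sym n} → Transposition r′ → Transposition r → r′ · r ≃ π →
                  r ≃ transpose a b ⊎ r ≃ transpose c d
  double-factor {r′ = r′} {r} T′ (p , q , p≢q , r≃) r′r≃π with q ≟ π ⟨$⟩ʳ p
  ... | no q≢πp = contradiction r′pq≃π (involution-no-factor T′ double-involutive p≢q p-moved (≢-sym q≢πp))
    where
    r′pq≃π : r′ · transpose p q ≃ π
    r′pq≃π = ≃-trans (·-congˡ r′ (≃-sym r≃)) r′r≃π
    p-moved : π ⟨$⟩ʳ p ≢ p
    p-moved = right-factor-moves T′ p≢q r′pq≃π (double≄ε δ)
  ... | yes refl = partner (moved⇒∈ π (a ∷ b ∷ c ∷ d ∷ []) (double-fixesOutside a b c d) p-moved)
    where
    r′pq≃π : r′ · transpose p (π ⟨$⟩ʳ p) ≃ π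
    r′pq≃π = ≃-trans (·-congˡ r′ (≃-sym r≃)) r′r≃π
    p-moved : π ⟨$⟩ʳ p ≢ p
    p-moved = right-factor-moves T′ p≢q r′pq≃π (double≄ε δ)
    partner : p ∈ a ∷ b ∷ c ∷ d ∷ [] → r ≃ transpose a b ⊎ r ≃ transpose c d
    partner 1st = inj₁ (≃-trans r≃ (≡⇒≃ (cong (transpose a) (double-a δ))))
    partner 2nd = inj₁ (≃-trans r≃ (≃-trans (≡⇒≃ (cong (transpose b) (double-b δ))) (transpose-comm b a)))
    partner 3rd = inj₂ (≃-trans r≃ (≡⇒≃ (cong (transpose c) (double-c δ))))
    partner 4th = inj₂ (≃-trans r≃ (≃-trans (≡⇒≃ (cong (transpose d) (double-d δ))) (transpose-comm d c)))

other-endpoint : a ≢ p → a ≢ q → p ∈ a ∷ b ∷ [] ⊎ q ∈ a ∷ b ∷ [] → p ≡ b ⊎ q ≡ b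
other-endpoint a≢p _ (inj₁ 1st) = contradiction refl a≢p
other-endpoint _ _ (inj₁ 2nd) = inj₁ refl
other-endpoint _ a≢q (inj₂ 1st) = contradiction refl a≢q
other-endpoint _ _ (inj₂ 2nd) = inj₂ refl

transpose-endpoints : u ≢ v → p ≡ u ⊎ q ≡ u → p ≡ v ⊎ q ≡ v → transpose p q ≃ transpose u v
transpose-endpoints u≢v (inj₁ refl) (inj₁ refl) = contradiction refl u≢v
transpose-endpoints u≢v (inj₁ refl) (inj₂ refl) = ≃-refl
transpose-endpoints u≢v (inj₂ refl) (inj₁ refl) = transpose-comm _ _
transpose-endpoints u≢v (inj₂ refl) (inj₂ refl) = contradiction refl u≢v

-- Adjacency and common neighbours in Cay(Sₙ, S)

record Adjacent (g h : Sym n) : Set where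
  constructor via
  field
    {s} : Sym n
    transposition : Transposition s
    g≃s·h : g ≃ s · h

Adj⇒Adjacent : (g h : Sym n) → Adj g h → Adjacent g h
Adj⇒Adjacent g h (s , (i , j , i≢j , s≈) , g≈) = via {s = s} (i , j , i≢j , mk≃ s≈) (mk≃ g≈)

Adjacent⇒Adj : Adjacent g h → Adj g h
Adjacent⇒Adj (via {s} (i , j , i≢j , s≃) g≃) = s , (i , j , i≢j , at s≃) , at g≃

adjacent : (h : Sym n) {s : Sym n} → Transposition s → Adjacent (s · h) h
adjacent h T = via T ≃-refl

Adjacent-resp : {g′ h′ : Sym n} → g ≃ g′ → h ≃ h′ → Adjacent g h → Adjacent g′ h′
Adjacent-resp g≃g′ h≃h′ (via {s} T g≃sh) =
  via T (≃-trans (≃-sym g≃g′) (≃-trans g≃sh (·-congˡ s h≃h′)))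

Adjacent-sym : Adjacent g h → Adjacent h g
Adjacent-sym {g = g} {h} (via {s} T g≃sh) = via T (begin
  h               ≈⟨ identityˡ h ⟨
  ε · h           ≈⟨ ·-congʳ h (transposition-involutive T) ⟨
  (s · s) · h     ≡⟨⟩
  s · (s · h)     ≈⟨ ·-congˡ s g≃sh ⟨
  s · g           ∎)

transposition-adjacent-ε : {s : Sym n} → Transposition s → Adjacent s ε
transposition-adjacent-ε {s = s} T = via T (≃-sym (identityʳ s))

adjacent-ε-transposition : {s : Sym n} → Adjacent s ε → Transposition s
adjacent-ε-transposition (via {t} T s≃tε) = Transposition-resp (≃-sym (≃-trans s≃tε (identityʳ t))) T

commonNeighbour-factors : {x y z π : Sym n} → Adjacent z x → Adjacent z y → π · x ≃ y →
                   ∃[ r ] ∃[ r′ ] (Transposition r × Transposition r′ × z ≃ r · x × r′ · r ≃ π)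
commonNeighbour-factors {x = x} {y} {z} {π} (via {r} T z≃rx) (via {r′} T′ z≃r′y) πx≃y =
  r , r′ , T , T′ , z≃rx , ∙-cancelʳ x (r′ · r) π (begin
    (r′ · r) · x     ≡⟨⟩
    r′ · (r · x)     ≈⟨ ·-congˡ r′ z≃rx ⟨
    r′ · z           ≈⟨ ·-congˡ r′ z≃r′y ⟩
    (r′ · r′) · y    ≈⟨ ·-congʳ y (transposition-involutive T′) ⟩
    ε · y            ≈⟨ identityˡ y ⟩
    y                ≈⟨ πx≃y ⟨
    π · x            ∎)

module _ {u v w : Fin n} (u≢v : u ≢ v) (v≢w : v ≢ w) (u≢w : u ≢ w) where

  cycle-adjacent-uv : Adjacent (cycle u v w) (transpose u v)
  cycle-adjacent-uv = Adjacent-resp (cycle-rotate (≢-sym u≢w) u≢v (≢-sym v≢w)) ≃-refl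
    (adjacent (transpose u v) (transpose-transposition (≢-sym u≢w)))

  cycle-adjacent-uw : Adjacent (cycle u v w) (transpose u w)
  cycle-adjacent-uw = Adjacent-resp (≃-sym (cycle-rotate u≢v v≢w u≢w)) (transpose-comm w u)
    (adjacent (transpose w u) (transpose-transposition v≢w))

  cycle-adjacent-vw : Adjacent (cycle u v w) (transpose v w)
  cycle-adjacent-vw = adjacent (transpose v w) (transpose-transposition u≢v)

  private
    wuv·uv≃uw : cycle w u v · transpose u v ≃ transpose u w
    wuv·uv≃uw = begin
      transpose w u · (transpose u v · transpose u v) ≈⟨ ·-congˡ (transpose w u) (transpose-involutive u v) ⟩
      transpose w u · ε                               ≈⟨ identityʳ (transpose w u) ⟩
      transpose w u                                   ≈⟨ transpose-comm w u ⟩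
      transpose u w                                   ∎

  sharing-commonNeighbour : {z : Sym n} → Adjacent z (transpose u v) → Adjacent z (transpose u w) → ¬ z ≃ ε →
                              z ≃ cycle u v w ⊎ z ≃ cycle u w v
  sharing-commonNeighbour {z = z} z~uv z~uw z≄ε with commonNeighbour-factors z~uv z~uw wuv·uv≃uw
  ... | r , r′ , T , T′ , z≃r·uv , r′r≃wuv with cycle-factor (≢-sym u≢w) u≢v (≢-sym v≢w) T′ T r′r≃wuv
  ... | inj₁ r≃wu = inj₁ (begin
    z                             ≈⟨ z≃r·uv ⟩
    r · transpose u v             ≈⟨ ·-congʳ (transpose u v) r≃wu ⟩
    cycle w u v                   ≈⟨ cycle-rotate (≢-sym u≢w) u≢v (≢-sym v≢w) ⟩
    cycle u v w                   ∎)
  ... | inj₂ (inj₁ r≃uv) = contradiction (≃-trans z≃r·uv (transpose-cancel r≃uv)) z≄ε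
  ... | inj₂ (inj₂ r≃wv) = inj₂ (begin
    z                             ≈⟨ z≃r·uv ⟩
    r · transpose u v             ≈⟨ ·-cong r≃wv (transpose-comm u v) ⟩
    cycle w v u                   ≈⟨ cycle-rotate (≢-sym v≢w) (≢-sym u≢v) (≢-sym u≢w) ⟩
    cycle v u w                   ≈⟨ cycle-rotate (≢-sym u≢v) u≢w v≢w ⟩
    cycle u w v                   ∎)

  cycle≄reverse : ¬ cycle u v w ≃ cycle u w v
  cycle≄reverse c≃c′ = u≢w (sym (trans (sym (cycle-v u≢w v≢w)) (trans (at c≃c′ v) (cycle-w u w v))))

record TwoCommonNeighbours (s t : Sym n) : Set where
  field
    {z₁ z₂} : Sym n
    z₁≄z₂ : ¬ z₁ ≃ z₂
    z₁≄ε : ¬ z₁ ≃ ε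
    z₂≄ε : ¬ z₂ ≃ ε
    z₁~s : Adjacent z₁ s
    z₁~t : Adjacent z₁ t
    z₂~s : Adjacent z₂ s
    z₂~t : Adjacent z₂ t

TwoCommonNeighbours-resp : {s s′ t t′ : Sym n} → s ≃ s′ → t ≃ t′ →
                           TwoCommonNeighbours s t → TwoCommonNeighbours s′ t′
TwoCommonNeighbours-resp s≃s′ t≃t′ P = record
  { z₁≄z₂ = z₁≄z₂ ; z₁≄ε = z₁≄ε ; z₂≄ε = z₂≄ε
  ; z₁~s = Adjacent-resp ≃-refl s≃s′ z₁~s ; z₁~t = Adjacent-resp ≃-refl t≃t′ z₁~t
  ; z₂~s = Adjacent-resp ≃-refl s≃s′ z₂~s ; z₂~t = Adjacent-resp ≃-refl t≃t′ z₂~t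
  }
  where open TwoCommonNeighbours P

sharing-twoCommonNeighbours : u ≢ v → v ≢ w → u ≢ w → TwoCommonNeighbours (transpose u v) (transpose u w)
sharing-twoCommonNeighbours u≢v v≢w u≢w = record
  { z₁≄z₂ = cycle≄reverse u≢v v≢w u≢w
  ; z₁≄ε = cycle≄ε u≢v u≢w
  ; z₂≄ε = cycle≄ε u≢w u≢v
  ; z₁~s = cycle-adjacent-uv u≢v v≢w u≢w
  ; z₁~t = cycle-adjacent-uw u≢v v≢w u≢w
  ; z₂~s = cycle-adjacent-uw u≢w (≢-sym v≢w) u≢v
  ; z₂~t = cycle-adjacent-uv u≢w (≢-sym v≢w) u≢v
  }

module _ {a b c d : Fin n} (δ : Distinct₄ a b c d) where

  private
    cdab·ab≃cd : (transpose c d · transpose a b) · transpose a b ≃ transpose c d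
    cdab·ab≃cd = ≃-trans (·-congˡ (transpose c d) (transpose-involutive a b)) (identityʳ (transpose c d))

  disjoint-commonNeighbour : {z : Sym n} → Adjacent z (transpose a b) → Adjacent z (transpose c d) → ¬ z ≃ ε →
                              z ≃ transpose a b · transpose c d
  disjoint-commonNeighbour {z = z} z~ab z~cd z≄ε with commonNeighbour-factors z~ab z~cd cdab·ab≃cd
  ... | r , r′ , T , T′ , z≃r·ab , r′r≃cdab with double-factor (Distinct₄-swap δ) T′ T r′r≃cdab
  ... | inj₁ r≃cd = begin
    z                             ≈⟨ z≃r·ab ⟩
    r · transpose a b             ≈⟨ ·-congʳ (transpose a b) r≃cd ⟩
    transpose c d · transpose a b ≈⟨ disjoint-comm δ ⟩
    transpose a b · transpose c d ∎
  ... | inj₂ r≃ab = contradiction (≃-trans z≃r·ab (transpose-cancel r≃ab)) z≄ε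

  disjoint-noTwoCommonNeighbours : ¬ TwoCommonNeighbours (transpose a b) (transpose c d)
  disjoint-noTwoCommonNeighbours P = z₁≄z₂ (≃-trans (disjoint-commonNeighbour z₁~s z₁~t z₁≄ε)
                                                  (≃-sym (disjoint-commonNeighbour z₂~s z₂~t z₂≄ε)))
    where open TwoCommonNeighbours P

shared-endpoint : {p q : Fin n} → p ≢ q → c ≢ d → TwoCommonNeighbours (transpose p q) (transpose c d) →
                  p ∈ c ∷ d ∷ [] ⊎ q ∈ c ∷ d ∷ []
shared-endpoint {c = c} {d} {p} {q} p≢q c≢d P with ∈⊎∉ p (c ∷ d ∷ []) | ∈⊎∉ q (c ∷ d ∷ [])
... | inj₁ p∈cd | _ = inj₁ p∈cd
... | inj₂ _ | inj₁ q∈cd = inj₂ q∈cd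
... | inj₂ (p≢c ∷ p≢d ∷ []) | inj₂ (q≢c ∷ q≢d ∷ []) = contradiction P (disjoint-noTwoCommonNeighbours δ)
  where δ = record { a≢b = p≢q ; a≢c = p≢c ; a≢d = p≢d ; b≢c = q≢c ; b≢d = q≢d ; c≢d = c≢d }

record CommonNeighbour₃ (s t r : Sym n) : Set where
  field
    {z} : Sym n
    z≄ε : ¬ z ≃ ε
    z~s : Adjacent z s
    z~t : Adjacent z t
    z~r : Adjacent z r

CommonNeighbour₃-resp : {s s′ t t′ r r′ : Sym n} → s ≃ s′ → t ≃ t′ → r ≃ r′ →
                        CommonNeighbour₃ s t r → CommonNeighbour₃ s′ t′ r′
CommonNeighbour₃-resp s≃s′ t≃t′ r≃r′ Z = record
  { z≄ε = z≄ε
  ; z~s = Adjacent-resp ≃-refl s≃s′ z~s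
  ; z~t = Adjacent-resp ≃-refl t≃t′ z~t
  ; z~r = Adjacent-resp ≃-refl r≃r′ z~r
  }
  where open CommonNeighbour₃ Z

triangle-commonNeighbour : a ≢ b → b ≢ c → a ≢ c →
                           CommonNeighbour₃ (transpose a b) (transpose a c) (transpose b c)
triangle-commonNeighbour a≢b b≢c a≢c = record
  { z≄ε = cycle≄ε a≢b a≢c
  ; z~s = cycle-adjacent-uv a≢b b≢c a≢c
  ; z~t = cycle-adjacent-uw a≢b b≢c a≢c
  ; z~r = cycle-adjacent-vw a≢b b≢c a≢c
  }

star-noCommonNeighbour : Distinct₄ a b c d → ¬ CommonNeighbour₃ (transpose a b) (transpose a c) (transpose a d)
star-noCommonNeighbour {a = a} {b} {c} {d} δ Z =
  moves-d (sharing-commonNeighbour a≢b b≢d a≢d z~s z~r z≄ε)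
          (fixes-d (sharing-commonNeighbour a≢b b≢c a≢c z~s z~t z≄ε))
  where
  open Distinct₄ δ
  open CommonNeighbour₃ Z
  fixes-d : z ≃ cycle a b c ⊎ z ≃ cycle a c b → z ⟨$⟩ʳ d ≡ d
  fixes-d (inj₁ z≃) = trans (at z≃ d) (cycle-fixesOutside a b c d (≢-sym a≢d ∷ ≢-sym b≢d ∷ ≢-sym c≢d ∷ []))
  fixes-d (inj₂ z≃) = trans (at z≃ d) (cycle-fixesOutside a c b d (≢-sym a≢d ∷ ≢-sym c≢d ∷ ≢-sym b≢d ∷ []))
  moves-d : z ≃ cycle a b d ⊎ z ≃ cycle a d b → z ⟨$⟩ʳ d ≢ d
  moves-d (inj₁ z≃) zd≡d = a≢d (trans (sym (cycle-w a b d)) (trans (sym (at z≃ d)) zd≡d))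
  moves-d (inj₂ z≃) zd≡d = b≢d (trans (sym (cycle-v a≢b (≢-sym b≢d))) (trans (sym (at z≃ d)) zd≡d))

record ThreeCommonNeighbours (s t : Sym n) : Set where
  field
    {z₁ z₂ z₃} : Sym n
    z₁≄z₂ : ¬ z₁ ≃ z₂
    z₁≄z₃ : ¬ z₁ ≃ z₃
    z₂≄z₃ : ¬ z₂ ≃ z₃
    z₁~s : Adjacent z₁ s
    z₁~t : Adjacent z₁ t
    z₂~s : Adjacent z₂ s
    z₂~t : Adjacent z₂ t
    z₃~s : Adjacent z₃ s
    z₃~t : Adjacent z₃ t

ThreeCommonNeighbours-resp : {s s′ t t′ : Sym n} → s ≃ s′ → t ≃ t′ →
                             ThreeCommonNeighbours s t → ThreeCommonNeighbours s′ t′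
ThreeCommonNeighbours-resp s≃s′ t≃t′ Z = record
  { z₁≄z₂ = z₁≄z₂ ; z₁≄z₃ = z₁≄z₃ ; z₂≄z₃ = z₂≄z₃
  ; z₁~s = Adjacent-resp ≃-refl s≃s′ z₁~s ; z₁~t = Adjacent-resp ≃-refl t≃t′ z₁~t
  ; z₂~s = Adjacent-resp ≃-refl s≃s′ z₂~s ; z₂~t = Adjacent-resp ≃-refl t≃t′ z₂~t
  ; z₃~s = Adjacent-resp ≃-refl s≃s′ z₃~s ; z₃~t = Adjacent-resp ≃-refl t≃t′ z₃~t
  }
  where open ThreeCommonNeighbours Z

module _ {u v w d : Fin n} (δ : Distinct₄ u v w d) where

  open Distinct₄ δ renaming (a≢b to u≢v; a≢c to u≢w; a≢d to u≢d; b≢c to v≢w; b≢d to v≢d; c≢d to w≢d)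

  cycle-split : cycle u v d ≃ cycle u w d · cycle u v w
  cycle-split = ≃-onPoints (u ∷ v ∷ w ∷ d ∷ [])
    (trans (cycle-u u≢v u≢d) (sym (trans (cong (cycle u w d ⟨$⟩ʳ_) (cycle-u u≢v u≢w))
                                         (cycle-fixesOutside u w d v (≢-sym u≢v ∷ v≢w ∷ v≢d ∷ [])))) ∷
     trans (cycle-v u≢d v≢d) (sym (trans (cong (cycle u w d ⟨$⟩ʳ_) (cycle-v u≢w v≢w)) (cycle-v u≢d w≢d))) ∷
     trans (cycle-fixesOutside u v d w (≢-sym u≢w ∷ ≢-sym v≢w ∷ w≢d ∷ []))
           (sym (trans (cong (cycle u w d ⟨$⟩ʳ_) (cycle-w u v w)) (cycle-u u≢w u≢d))) ∷
     trans (cycle-w u v d) (sym (trans (cong (cycle u w d ⟨$⟩ʳ_)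
             (cycle-fixesOutside u v w d (≢-sym u≢d ∷ ≢-sym v≢d ∷ ≢-sym w≢d ∷ []))) (cycle-w u w d))) ∷ [])
    λ { x (x≢u ∷ x≢v ∷ x≢w ∷ x≢d ∷ []) →
          trans (cycle-fixesOutside u v d x (x≢u ∷ x≢v ∷ x≢d ∷ []))
                (sym (trans (cong (cycle u w d ⟨$⟩ʳ_) (cycle-fixesOutside u v w x (x≢u ∷ x≢v ∷ x≢w ∷ [])))
                            (cycle-fixesOutside u w d x (x≢u ∷ x≢w ∷ x≢d ∷ [])))) }

  private
    δ′ : Distinct₄ u w d v
    δ′ = record { a≢b = u≢w ; a≢c = u≢d ; a≢d = u≢v ; b≢c = w≢d ; b≢d = ≢-sym v≢w ; c≢d = ≢-sym v≢d }

  cycle-via-double : cycle u v w ≃ (transpose u w · transpose d v) · cycle u d v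
  cycle-via-double = ≃-onPoints (u ∷ v ∷ w ∷ d ∷ [])
    (trans (cycle-u u≢v u≢w) (sym (trans (cong (π ⟨$⟩ʳ_) (cycle-u u≢d u≢v)) (double-c δ′))) ∷
     trans (cycle-v u≢w v≢w) (sym (trans (cong (π ⟨$⟩ʳ_) (cycle-w u d v)) (double-a δ′))) ∷
     trans (cycle-w u v w) (sym (trans (cong (π ⟨$⟩ʳ_)
             (cycle-fixesOutside u d v w (≢-sym u≢w ∷ w≢d ∷ ≢-sym v≢w ∷ []))) (double-b δ′))) ∷
     trans (cycle-fixesOutside u v w d (≢-sym u≢d ∷ ≢-sym v≢d ∷ ≢-sym w≢d ∷ []))
           (sym (trans (cong (π ⟨$⟩ʳ_) (cycle-v u≢v (≢-sym v≢d))) (double-d δ′))) ∷ [])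
    λ { x (x≢u ∷ x≢v ∷ x≢w ∷ x≢d ∷ []) →
          trans (cycle-fixesOutside u v w x (x≢u ∷ x≢v ∷ x≢w ∷ []))
                (sym (trans (cong (π ⟨$⟩ʳ_) (cycle-fixesOutside u d v x (x≢u ∷ x≢d ∷ x≢v ∷ [])))
                            (double-fixesOutside u w d v x (x≢u ∷ x≢w ∷ x≢d ∷ x≢v ∷ [])))) }
    where π = transpose u w · transpose d v

  cycles-threeCommonNeighbours : ThreeCommonNeighbours (cycle u v w) (cycle u v d)
  cycles-threeCommonNeighbours = record
    { z₁ = transpose w d · γ
    ; z₂ = transpose d u · γ
    ; z₃ = transpose u w · γ
    ; z₁≄z₂ = λ z₁≃z₂ → w≢d (sym (trans (sym (transpose-fst w d))
                 (trans (at (∙-cancelʳ γ (transpose w d) (transpose d u) z₁≃z₂) w)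
                        (transpose-fix w≢d (≢-sym u≢w)))))
    ; z₁≄z₃ = λ z₁≃z₃ → w≢d (trans (sym (transpose-snd w d))
                 (trans (at (∙-cancelʳ γ (transpose w d) (transpose u w) z₁≃z₃) d)
                        (transpose-fix (≢-sym u≢d) (≢-sym w≢d))))
    ; z₂≄z₃ = λ z₂≃z₃ → u≢d (trans (sym (transpose-fst d u))
                 (trans (at (∙-cancelʳ γ (transpose d u) (transpose u w) z₂≃z₃) d)
                        (transpose-fix (≢-sym u≢d) (≢-sym w≢d))))
    ; z₁~s = adjacent γ (transpose-transposition w≢d)
    ; z₁~t = Adjacent-sym (via (transpose-transposition u≢w) cycle-split)
    ; z₂~s = adjacent γ (transpose-transposition (≢-sym u≢d))
    ; z₂~t = Adjacent-sym (via (transpose-transposition w≢d) split₂)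
    ; z₃~s = adjacent γ (transpose-transposition u≢w)
    ; z₃~t = Adjacent-sym (via (transpose-transposition (≢-sym u≢d)) split₃)
    }
    where
    γ = cycle u v w
    split₂ : cycle u v d ≃ transpose w d · (transpose d u · γ)
    split₂ = ≃-trans cycle-split (·-congʳ γ (cycle-rotate u≢w w≢d u≢d))
    split₃ : cycle u v d ≃ transpose d u · (transpose u w · γ)
    split₃ = ≃-trans split₂ (·-congʳ γ (cycle-rotate w≢d (≢-sym u≢d) (≢-sym u≢w)))

  reversed-noThreeCommonNeighbours : ¬ ThreeCommonNeighbours (cycle u v w) (cycle u d v)
  reversed-noThreeCommonNeighbours Z =
    at-most-two (classify z₁~s z₁~t) (classify z₂~s z₂~t) (classify z₃~s z₃~t)
    where
    open ThreeCommonNeighbours Z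
    γ′ = cycle u d v
    classify : {z : Sym n} → Adjacent z (cycle u v w) → Adjacent z γ′ →
               z ≃ transpose u w · γ′ ⊎ z ≃ transpose d v · γ′
    classify z~c z~γ′ with commonNeighbour-factors z~γ′ z~c (≃-sym cycle-via-double)
    ... | r , r′ , T , T′ , z≃r·γ′ , r′r≃π with double-factor δ′ T′ T r′r≃π
    ...   | inj₁ r≃uw = inj₁ (≃-trans z≃r·γ′ (·-congʳ γ′ r≃uw))
    ...   | inj₂ r≃dv = inj₂ (≃-trans z≃r·γ′ (·-congʳ γ′ r≃dv))
    at-most-two : z₁ ≃ transpose u w · γ′ ⊎ z₁ ≃ transpose d v · γ′ →
                 z₂ ≃ transpose u w · γ′ ⊎ z₂ ≃ transpose d v · γ′ →
                 z₃ ≃ transpose u w · γ′ ⊎ z₃ ≃ transpose d v · γ′ → ⊥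
    at-most-two (inj₁ p) (inj₁ q) _ = z₁≄z₂ (≃-trans p (≃-sym q))
    at-most-two (inj₂ p) (inj₂ q) _ = z₁≄z₂ (≃-trans p (≃-sym q))
    at-most-two (inj₁ p) _ (inj₁ q) = z₁≄z₃ (≃-trans p (≃-sym q))
    at-most-two (inj₂ p) _ (inj₂ q) = z₁≄z₃ (≃-trans p (≃-sym q))
    at-most-two _ (inj₁ p) (inj₁ q) = z₂≄z₃ (≃-trans p (≃-sym q))
    at-most-two _ (inj₂ p) (inj₂ q) = z₂≄z₃ (≃-trans p (≃-sym q))

module Automorphism (φ : Aut n) where

  F G : Sym n → Sym n
  F = Aut.f φ
  G = Aut.g φ

  F-cong : σ ≃ τ → F σ ≃ F τ
  F-cong σ≃τ = mk≃ (Aut.f-resp φ (at σ≃τ))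

  G-cong : σ ≃ τ → G σ ≃ G τ
  G-cong σ≃τ = mk≃ (Aut.g-resp φ (at σ≃τ))

  F∘G : (σ : Sym n) → F (G σ) ≃ σ
  F∘G σ = mk≃ (Aut.fg φ σ)

  G∘F : (σ : Sym n) → G (F σ) ≃ σ
  G∘F σ = mk≃ (Aut.gf φ σ)

  F-injective : F σ ≃ F τ → σ ≃ τ
  F-injective {σ = σ} {τ} Fσ≃Fτ = ≃-trans (≃-sym (G∘F σ)) (≃-trans (G-cong Fσ≃Fτ) (G∘F τ))

  fixed-resp : σ ≃ τ → F τ ≃ τ → F σ ≃ σ
  fixed-resp σ≃τ Fτ≃τ = ≃-trans (F-cong σ≃τ) (≃-trans Fτ≃τ (≃-sym σ≃τ))

  F-adjacent : Adjacent σ τ → Adjacent (F σ) (F τ)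
  F-adjacent {σ = σ} {τ} σ~τ = Adj⇒Adjacent (F σ) (F τ) (Aut.adj-pres φ σ τ (Adjacent⇒Adj σ~τ))

  F-adjacent⁻¹ : Adjacent (F σ) (F τ) → Adjacent σ τ
  F-adjacent⁻¹ {σ = σ} {τ} Fσ~Fτ = Adj⇒Adjacent σ τ (Aut.adj-refl φ σ τ (Adjacent⇒Adj Fσ~Fτ))

  G-adjacent : Adjacent σ τ → Adjacent (G σ) (G τ)
  G-adjacent {σ = σ} {τ} σ~τ = F-adjacent⁻¹ (Adjacent-resp (≃-sym (F∘G σ)) (≃-sym (F∘G τ)) σ~τ)

  F-threeCommonNeighbours : {s t : Sym n} → ThreeCommonNeighbours s t → ThreeCommonNeighbours (F s) (F t)
  F-threeCommonNeighbours Z = record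
    { z₁≄z₂ = λ eq → z₁≄z₂ (F-injective eq)
    ; z₁≄z₃ = λ eq → z₁≄z₃ (F-injective eq)
    ; z₂≄z₃ = λ eq → z₂≄z₃ (F-injective eq)
    ; z₁~s = F-adjacent z₁~s ; z₁~t = F-adjacent z₁~t
    ; z₂~s = F-adjacent z₂~s ; z₂~t = F-adjacent z₂~t
    ; z₃~s = F-adjacent z₃~s ; z₃~t = F-adjacent z₃~t
    }
    where open ThreeCommonNeighbours Z

  module FixingIdentity (Fε≃ε : F ε ≃ ε) where

    F-≄ε : ¬ σ ≃ ε → ¬ F σ ≃ ε
    F-≄ε σ≄ε Fσ≃ε = σ≄ε (F-injective (≃-trans Fσ≃ε (≃-sym Fε≃ε)))

    F-transposition : {s : Sym n} → Transposition s → Transposition (F s)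
    F-transposition T =
      adjacent-ε-transposition (Adjacent-resp ≃-refl Fε≃ε (F-adjacent (transposition-adjacent-ε T)))

    F-twoCommonNeighbours : {s t : Sym n} → TwoCommonNeighbours s t → TwoCommonNeighbours (F s) (F t)
    F-twoCommonNeighbours P = record
      { z₁≄z₂ = λ eq → z₁≄z₂ (F-injective eq)
      ; z₁≄ε = F-≄ε z₁≄ε ; z₂≄ε = F-≄ε z₂≄ε
      ; z₁~s = F-adjacent z₁~s ; z₁~t = F-adjacent z₁~t
      ; z₂~s = F-adjacent z₂~s ; z₂~t = F-adjacent z₂~t
      }
      where open TwoCommonNeighbours P

    F-commonNeighbour₃⁻¹ : {s t r : Sym n} → CommonNeighbour₃ (F s) (F t) (F r) → CommonNeighbour₃ s t r
    F-commonNeighbour₃⁻¹ Z = record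
      { z≄ε = λ Gz≃ε → z≄ε (≃-trans (≃-sym (F∘G z)) (≃-trans (F-cong Gz≃ε) Fε≃ε))
      ; z~s = F-adjacent⁻¹ (Adjacent-resp (≃-sym (F∘G z)) ≃-refl z~s)
      ; z~t = F-adjacent⁻¹ (Adjacent-resp (≃-sym (F∘G z)) ≃-refl z~t)
      ; z~r = F-adjacent⁻¹ (Adjacent-resp (≃-sym (F∘G z)) ≃-refl z~r)
      }
      where open CommonNeighbour₃ Z

Aut-inverse : Aut n → Aut n
Aut-inverse φ = record
  { f = G ; g = F
  ; f-resp = Aut.g-resp φ ; g-resp = Aut.f-resp φ
  ; fg = Aut.gf φ ; gf = Aut.fg φ
  ; adj-pres = λ σ τ σ~τ → Adjacent⇒Adj (G-adjacent (Adj⇒Adjacent σ τ σ~τ))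
  ; adj-refl = λ σ τ Gσ~Gτ → Adjacent⇒Adj
      (Adjacent-resp (F∘G σ) (F∘G τ) (F-adjacent (Adj⇒Adjacent (G σ) (G τ) Gσ~Gτ)))
  }
  where open Automorphism φ

infixr 9 _∘ᴬ_
_∘ᴬ_ : Aut n → Aut n → Aut n
φ ∘ᴬ ψ = record
  { f = λ σ → Φ.F (Ψ.F σ) ; g = λ σ → Ψ.G (Φ.G σ)
  ; f-resp = λ σ≈τ → Aut.f-resp φ (Aut.f-resp ψ σ≈τ)
  ; g-resp = λ σ≈τ → Aut.g-resp ψ (Aut.g-resp φ σ≈τ)
  ; fg = λ σ → at (≃-trans (Φ.F-cong (Ψ.F∘G (Φ.G σ))) (Φ.F∘G σ))
  ; gf = λ σ → at (≃-trans (Ψ.G-cong (Φ.G∘F (Ψ.F σ))) (Ψ.G∘F σ))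
  ; adj-pres = λ σ τ σ~τ → Aut.adj-pres φ _ _ (Aut.adj-pres ψ σ τ σ~τ)
  ; adj-refl = λ σ τ ΦΨσ~ΦΨτ → Aut.adj-refl ψ σ τ (Aut.adj-refl φ _ _ ΦΨσ~ΦΨτ)
  }
  where
  module Φ = Automorphism φ
  module Ψ = Automorphism ψ

right-translation : Sym n → Aut n
right-translation a = record
  { f = λ σ → σ · a ; g = λ σ → σ · (a ⁻¹)
  ; f-resp = λ {σ} {τ} σ≈τ → at (·-congʳ a (mk≃ {σ = σ} {τ} σ≈τ))
  ; g-resp = λ {σ} {τ} σ≈τ → at (·-congʳ (a ⁻¹) (mk≃ {σ = σ} {τ} σ≈τ))
  ; fg = λ σ → at (≃-trans (·-congˡ σ (inverseˡ a)) (identityʳ σ))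
  ; gf = λ σ → at (≃-trans (·-congˡ σ (inverseʳ a)) (identityʳ σ))
  ; adj-pres = λ σ τ σ~τ → Adjacent⇒Adj (translate (Adj⇒Adjacent σ τ σ~τ))
  ; adj-refl = λ σ τ σa~τa → Adjacent⇒Adj (untranslate σ τ (Adj⇒Adjacent (σ · a) (τ · a) σa~τa))
  }
  where
  translate : Adjacent σ τ → Adjacent (σ · a) (τ · a)
  translate (via {s} T σ≃sτ) = via T (·-congʳ a σ≃sτ)
  untranslate : (σ τ : Sym _) → Adjacent (σ · a) (τ · a) → Adjacent σ τ
  untranslate σ τ (via {s} T σa≃sτa) = via T (∙-cancelʳ a σ (s · τ) σa≃sτa)

-- Rigidity

data TranspositionProduct (p q p′ q′ : Fin n) : Set where
  identity    : transpose p q · transpose p′ q′ ≃ ε → TranspositionProduct p q p′ q′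
  three-cycle : {u v w : Fin n} → u ≢ v → v ≢ w → u ≢ w →
                transpose p q · transpose p′ q′ ≃ cycle u v w → TranspositionProduct p q p′ q′
  disjoint    : Distinct₄ p q p′ q′ → TranspositionProduct p q p′ q′

transposition-product : p ≢ q → p′ ≢ q′ → TranspositionProduct p q p′ q′
transposition-product {p = p} {q} {p′} {q′} p≢q p′≢q′ with p ≟ p′ | p ≟ q′ | q ≟ p′ | q ≟ q′
... | yes refl | _ | _ | yes refl = identity (transpose-involutive p q)
... | yes refl | _ | _ | no q≢q′ =
  three-cycle (≢-sym p≢q) p′≢q′ q≢q′ (·-congʳ (transpose p q′) (transpose-comm p q))
... | no _ | yes refl | yes refl | _ =
  identity (≃-trans (·-congˡ (transpose p q) (transpose-comm q p)) (transpose-involutive p q))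
... | no p≢p′ | yes refl | no q≢p′ | _ =
  three-cycle (≢-sym p≢q) p≢p′ q≢p′ (·-cong (transpose-comm p q) (transpose-comm p′ p))
... | no _ | no p≢q′ | yes refl | _ = three-cycle p≢q p′≢q′ p≢q′ ≃-refl
... | no p≢p′ | no _ | no q≢p′ | yes refl =
  three-cycle p≢q q≢p′ p≢p′ (·-congˡ (transpose p q) (transpose-comm p′ q))
... | no p≢p′ | no p≢q′ | no q≢p′ | no q≢q′ = disjoint (record
  { a≢b = p≢q ; a≢c = p≢p′ ; a≢d = p≢q′ ; b≢c = q≢p′ ; b≢d = q≢q′ ; c≢d = p′≢q′ })

FixesTranspositions : Aut n → Set
FixesTranspositions {n} χ = ∀ {i j : Fin n} → i ≢ j → Automorphism.F χ (transpose i j) ≃ transpose i j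

record FixedCycle (χ : Aut n) (u v w : Fin n) : Set where
  field
    u≢v : u ≢ v
    v≢w : v ≢ w
    u≢w : u ≢ w
    fixed : Automorphism.F χ (cycle u v w) ≃ cycle u v w

record Anchored (χ : Aut n) : Set where
  field
    fixes-ε : Automorphism.F χ ε ≃ ε
    fixes-transpositions : FixesTranspositions χ
    {u₀ v₀ w₀} : Fin n
    anchor : FixedCycle χ u₀ v₀ w₀

module AnchoredProperties {χ : Aut n} (A : Anchored χ) where

  open Automorphism χ
  open Anchored A
  open FixingIdentity fixes-ε

  cycle-image : {u v w : Fin n} → u ≢ v → v ≢ w → u ≢ w →
                F (cycle u v w) ≃ cycle u v w ⊎ F (cycle u v w) ≃ cycle u w v
  cycle-image u≢v v≢w u≢w = sharing-commonNeighbour u≢v v≢w u≢w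
    (Adjacent-resp ≃-refl (fixes-transpositions u≢v) (F-adjacent (cycle-adjacent-uv u≢v v≢w u≢w)))
    (Adjacent-resp ≃-refl (fixes-transpositions u≢w) (F-adjacent (cycle-adjacent-uw u≢v v≢w u≢w)))
    (F-≄ε (cycle≄ε u≢v u≢w))

  module _ {u v w : Fin n} (C : FixedCycle χ u v w) where

    open FixedCycle C

    FixedCycle-rotate : FixedCycle χ v w u
    FixedCycle-rotate = record
      { u≢v = v≢w ; v≢w = ≢-sym u≢w ; u≢w = ≢-sym u≢v
      ; fixed = fixed-resp (≃-sym (cycle-rotate u≢v v≢w u≢w)) fixed }

    FixedCycle-reverse : FixedCycle χ u w v
    FixedCycle-reverse = record
      { u≢v = u≢w ; v≢w = ≢-sym v≢w ; u≢w = u≢v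
      ; fixed = [ id , (λ F≃ → contradiction (F-injective (≃-trans F≃ (≃-sym fixed)))
                                             (cycle≄reverse u≢w (≢-sym v≢w) u≢v)) ]′
                (cycle-image u≢w (≢-sym v≢w) u≢v) }

    FixedCycle-extend : {d : Fin n} → u ≢ d → v ≢ d → w ≢ d → FixedCycle χ u v d
    FixedCycle-extend u≢d v≢d w≢d = record
      { u≢v = u≢v ; v≢w = v≢d ; u≢w = u≢d
      ; fixed = [ id , (λ F≃ → contradiction
                  (ThreeCommonNeighbours-resp fixed F≃ (F-threeCommonNeighbours (cycles-threeCommonNeighbours δ)))
                  (reversed-noThreeCommonNeighbours δ)) ]′
                (cycle-image u≢v v≢d u≢d) }
      where
      δ : Distinct₄ u v w _
      δ = record { a≢b = u≢v ; a≢c = u≢w ; a≢d = u≢d ; b≢c = v≢w ; b≢d = v≢d ; c≢d = w≢d }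

    FixedCycle-replace : {d : Fin n} → d ≢ u → d ≢ v → FixedCycle χ u v d
    FixedCycle-replace {d} d≢u d≢v with d ≟ w
    ... | yes refl = C
    ... | no d≢w = FixedCycle-extend (≢-sym d≢u) (≢-sym d≢v) (≢-sym d≢w)

  FixedCycle-from : {u v w : Fin n} → FixedCycle χ u v w → (x : Fin n) → ∃[ y ] ∃[ z ] FixedCycle χ x y z
  FixedCycle-from {u} {v} {w} C x with x ≟ u | x ≟ v
  ... | yes refl | _ = v , w , C
  ... | no _ | yes refl = w , u , FixedCycle-rotate C
  ... | no x≢u | no x≢v = u , v , FixedCycle-rotate (FixedCycle-rotate (FixedCycle-replace C x≢u x≢v))

  FixedCycle-through : {x y z : Fin n} → FixedCycle χ x y z → {y′ : Fin n} → y′ ≢ x → ∃[ z′ ] FixedCycle χ x y′ z′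
  FixedCycle-through {y = y} {z} C {y′} y′≢x with y′ ≟ z
  ... | yes refl = y , FixedCycle-reverse C
  ... | no y′≢z = z , FixedCycle-rotate (FixedCycle-replace (FixedCycle-rotate (FixedCycle-rotate C)) y′≢z y′≢x)

  fixed-cycle : {x y z : Fin n} → x ≢ y → y ≢ z → x ≢ z → FixedCycle χ x y z
  fixed-cycle {x} x≢y y≢z x≢z with FixedCycle-from anchor x
  ... | _ , _ , C₁ with FixedCycle-through C₁ (≢-sym x≢y)
  ... | _ , C₂ = FixedCycle-replace C₂ (≢-sym x≢z) (≢-sym y≢z)

  fixes-transposition-products : {p q p′ q′ : Fin n} → p ≢ q → p′ ≢ q′ →
                                 F (transpose p q · transpose p′ q′) ≃ transpose p q · transpose p′ q′
  fixes-transposition-products {p} {q} {p′} {q′} p≢q p′≢q′ with transposition-product p≢q p′≢q′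
  ... | identity π≃ε = fixed-resp π≃ε fixes-ε
  ... | three-cycle u≢v v≢w u≢w π≃cycle = fixed-resp π≃cycle (FixedCycle.fixed (fixed-cycle u≢v v≢w u≢w))
  ... | disjoint δ = disjoint-commonNeighbour δ
    (Adjacent-resp ≃-refl (fixes-transpositions p≢q)
      (F-adjacent (Adjacent-resp (disjoint-comm δ) ≃-refl
                    (adjacent (transpose p q) (transpose-transposition p′≢q′)))))
    (Adjacent-resp ≃-refl (fixes-transpositions p′≢q′)
      (F-adjacent (adjacent (transpose p′ q′) (transpose-transposition p≢q))))
    (F-≄ε (double≄ε δ))

conjugate : Aut n → Sym n → Aut n
conjugate χ t = right-translation t ∘ᴬ χ ∘ᴬ right-translation t

module _ {k : ℕ} where

  private
    N = 3 + k

  conjugate-anchored : {χ : Aut N} → Anchored χ → {i j : Fin N} → i ≢ j → Anchored (conjugate χ (transpose i j))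
  conjugate-anchored {χ} A {i} {j} i≢j = record
    { fixes-ε = ≃-trans (·-congʳ t (≃-trans (F-cong (identityˡ t)) (fixes-transpositions i≢j)))
                        (transpose-involutive i j)
    ; fixes-transpositions = λ {p} {q} p≢q → begin
        F (transpose p q · t) · t      ≈⟨ ·-congʳ t (fixes-transposition-products p≢q i≢j) ⟩
        transpose p q · (t · t)        ≈⟨ ·-congˡ (transpose p q) (transpose-involutive i j) ⟩
        transpose p q · ε              ≈⟨ identityʳ (transpose p q) ⟩
        transpose p q                  ∎
    ; u₀ = x ; v₀ = i ; w₀ = j
    ; anchor = record
      { u≢v = x≢i ; v≢w = i≢j ; u≢w = x≢j
      ; fixed = ·-congʳ t (≃-trans (F-cong xij·t≃xi) (fixes-transpositions x≢i)) }
    }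
    where
    open Automorphism χ
    open Anchored A
    open AnchoredProperties A
    t = transpose i j
    x = proj₁ (fresh-point i j)
    x≢i = proj₁ (proj₂ (fresh-point i j))
    x≢j = proj₂ (proj₂ (fresh-point i j))
    xij·t≃xi : cycle x i j · t ≃ transpose x i
    xij·t≃xi = ≃-trans (·-congˡ (transpose x i) (transpose-involutive i j)) (identityʳ (transpose x i))

  anchored-fixes-eval : (xs : TranspositionList N) {χ : Aut N} → Anchored χ →
                        Automorphism.F χ (eval xs) ≃ eval xs
  anchored-fixes-eval [] A = Anchored.fixes-ε A
  anchored-fixes-eval ((i , j) ∷ xs) {χ} A with i ≟ j
  ... | yes refl = fixed-resp (≃-trans (·-congˡ (eval xs) (transpose-same i)) (identityʳ (eval xs)))
                              (anchored-fixes-eval xs A)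
    where open Automorphism χ
  ... | no i≢j = begin
      F (ρ · t)                 ≈⟨ identityʳ (F (ρ · t)) ⟨
      F (ρ · t) · ε             ≈⟨ ·-congˡ (F (ρ · t)) (transpose-involutive i j) ⟨
      (F (ρ · t) · t) · t       ≈⟨ ·-congʳ t (anchored-fixes-eval xs (conjugate-anchored A i≢j)) ⟩
      ρ · t                     ∎
    where
    open Automorphism χ
    ρ = eval xs
    t = transpose i j

  anchored⇒identity : {χ : Aut N} → Anchored χ → (σ : Sym N) → Automorphism.F χ σ ≃ σ
  anchored⇒identity {χ} A σ = fixed-resp (≃-sym (mk≃ (eval-decompose σ))) (anchored-fixes-eval (decompose σ) A)
    where open Automorphism χ

-- Automorphisms fixing ε

side : {A B : Set} → A ⊎ B → Fin 2
side (inj₁ _) = 0F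
side (inj₂ _) = 1F

same-side : {A B C D : Set} (p : A ⊎ B) (q : C ⊎ D) → side p ≡ side q → (A × C) ⊎ (B × D)
same-side (inj₁ a) (inj₁ c) _ = inj₁ (a , c)
same-side (inj₂ b) (inj₂ d) _ = inj₂ (b , d)

record Wedge (s t : Sym n) : Set where
  field
    {centre b₁ b₂} : Fin n
    centre≢b₁ : centre ≢ b₁
    centre≢b₂ : centre ≢ b₂
    b₁≢b₂ : b₁ ≢ b₂
    s≃ : s ≃ transpose centre b₁
    t≃ : t ≃ transpose centre b₂

wedge-from : {s t : Sym n} {c b₁ b₂ : Fin n} → c ≢ b₁ → c ≢ b₂ →
             s ≃ transpose c b₁ → t ≃ transpose c b₂ → ¬ s ≃ t → Wedge s t
wedge-from c≢b₁ c≢b₂ s≃ t≃ s≄t = record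
  { centre≢b₁ = c≢b₁ ; centre≢b₂ = c≢b₂
  ; b₁≢b₂ = λ { refl → s≄t (≃-trans s≃ (≃-sym t≃)) }
  ; s≃ = s≃ ; t≃ = t≃ }

wedge : {s t : Sym n} → Transposition s → Transposition t → ¬ s ≃ t → TwoCommonNeighbours s t → Wedge s t
wedge (p₁ , q₁ , p₁≢q₁ , s≃) (p₂ , q₂ , p₂≢q₂ , t≃) s≄t P
  with shared-endpoint p₁≢q₁ p₂≢q₂ (TwoCommonNeighbours-resp s≃ t≃ P)
... | inj₁ 1st = wedge-from p₁≢q₁ p₂≢q₂ s≃ t≃ s≄t
... | inj₁ 2nd = wedge-from p₁≢q₁ (≢-sym p₂≢q₂) s≃ (≃-trans t≃ (transpose-comm p₂ q₂)) s≄t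
... | inj₂ 1st = wedge-from (≢-sym p₁≢q₁) p₂≢q₂ (≃-trans s≃ (transpose-comm p₁ q₁)) t≃ s≄t
... | inj₂ 2nd = wedge-from (≢-sym p₁≢q₁) (≢-sym p₂≢q₂)
                   (≃-trans s≃ (transpose-comm p₁ q₁)) (≃-trans t≃ (transpose-comm p₂ q₂)) s≄t

module Stabiliser {k : ℕ} {φ : Aut (3 + k)} (Fε≃ε : Automorphism.F φ ε ≃ ε) where

  open Automorphism φ
  open FixingIdentity Fε≃ε

  private
    N = 3 + k
    star-injective : {i j : Fin N} → transpose 0F i ≃ transpose 0F j → i ≡ j
    star-injective 0i≃0j = trans (sym (transpose-fst 0F _)) (trans (at 0i≃0j 0F) (transpose-fst 0F _))

  star-transposition : {i : Fin N} → i ≢ 0F → Transposition (F (transpose 0F i))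
  star-transposition i≢0 = F-transposition (transpose-transposition (≢-sym i≢0))

  star-twoCommonNeighbours : {i j : Fin N} → i ≢ 0F → j ≢ 0F → i ≢ j →
                             TwoCommonNeighbours (F (transpose 0F i)) (F (transpose 0F j))
  star-twoCommonNeighbours i≢0 j≢0 i≢j =
    F-twoCommonNeighbours (sharing-twoCommonNeighbours (≢-sym i≢0) i≢j (≢-sym j≢0))

  fixed-star⇒fixesTranspositions : (∀ {i} → i ≢ 0F → F (transpose 0F i) ≃ transpose 0F i) → FixesTranspositions φ
  fixed-star⇒fixesTranspositions fixed-star {i} {j} i≢j with i ≟ 0F | j ≟ 0F
  ... | yes refl | _ = fixed-star (≢-sym i≢j)
  ... | no i≢0 | yes refl = ≃-trans (F-cong (transpose-comm i 0F)) (≃-trans (fixed-star i≢0) (transpose-comm 0F i))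
  ... | no i≢0 | no j≢0 with F-transposition (transpose-transposition i≢j)
  ... | p , q , p≢q , F≃pq = ≃-trans F≃pq (transpose-endpoints i≢j (meets i≢0 j≢0 ≃-refl i≢j)
                                                                  (meets j≢0 i≢0 (transpose-comm i j) (≢-sym i≢j)))
    where
    avoids-0 : {y : Fin N} → y ≢ 0F → ¬ F (transpose i j) ≃ transpose 0F y
    avoids-0 y≢0 F≃0y = y≢0 (trans (sym (transpose-fst 0F _))
      (trans (sym (at (F-injective (≃-trans F≃0y (≃-sym (fixed-star y≢0)))) 0F))
             (transpose-fix (λ 0≡i → i≢0 (sym 0≡i)) (λ 0≡j → j≢0 (sym 0≡j)))))
    0≢p : 0F ≢ p
    0≢p refl = avoids-0 (≢-sym p≢q) F≃pq
    0≢q : 0F ≢ q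
    0≢q refl = avoids-0 p≢q (≃-trans F≃pq (transpose-comm p 0F))
    meets : {x y : Fin N} → x ≢ 0F → y ≢ 0F → transpose i j ≃ transpose x y → x ≢ y → p ≡ x ⊎ q ≡ x
    meets {x} {y} x≢0 y≢0 ij≃xy x≢y = other-endpoint 0≢p 0≢q (shared-endpoint p≢q (≢-sym x≢0)
      (TwoCommonNeighbours-resp (≃-trans (F-cong (≃-sym ij≃xy)) F≃pq)
        (≃-trans (F-cong (transpose-comm x 0F)) (fixed-star x≢0))
        (F-twoCommonNeighbours (sharing-twoCommonNeighbours x≢y y≢0 x≢0))))

  -- Opaque, as unfolding the case analyses behind this proof (and star-cycle-image below)
  -- makes type checking explode.
  opaque
    star-wedge : Wedge (F (transpose 0F 1F)) (F (transpose 0F 2F))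
    star-wedge = wedge (star-transposition (λ ())) (star-transposition (λ ()))
                       (λ F≃ → contradiction (star-injective (F-injective F≃)) (λ ()))
                       (star-twoCommonNeighbours (λ ()) (λ ()) (λ ()))

  module _ (W : Wedge (F (transpose 0F 1F)) (F (transpose 0F 2F))) where

    open Wedge W

    star-leaf : {i : Fin N} → i ≢ 0F → ∃[ b ] (b ≢ centre × F (transpose 0F i) ≃ transpose centre b)
    star-leaf {i} i≢0 with i ≟ 1F | i ≟ 2F
    ... | yes refl | _ = b₁ , ≢-sym centre≢b₁ , s≃
    ... | no _ | yes refl = b₂ , ≢-sym centre≢b₂ , t≃
    ... | no i≢1 | no i≢2 with star-transposition i≢0
    ... | p , q , p≢q , F≃pq with ∈⊎∉ centre (p ∷ q ∷ [])
    ...   | inj₁ 1st = q , ≢-sym p≢q , F≃pq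
    ...   | inj₁ 2nd = p , p≢q , ≃-trans F≃pq (transpose-comm p q)
    ...   | inj₂ (c≢p ∷ c≢q ∷ []) = contradiction
      (F-commonNeighbour₃⁻¹ (CommonNeighbour₃-resp (≃-sym s≃) (≃-sym t≃) (≃-sym (≃-trans F≃pq pq≃b₁b₂))
                               (triangle-commonNeighbour centre≢b₁ b₁≢b₂ centre≢b₂)))
      (star-noCommonNeighbour (record { a≢b = λ () ; a≢c = λ () ; a≢d = ≢-sym i≢0
                                      ; b≢c = λ () ; b≢d = ≢-sym i≢1 ; c≢d = ≢-sym i≢2 }))
      where
      meets : {j b : Fin N} → j ≢ 0F → i ≢ j → centre ≢ b → F (transpose 0F j) ≃ transpose centre b → p ≡ b ⊎ q ≡ b
      meets j≢0 i≢j centre≢b F≃cb = other-endpoint c≢p c≢q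
        (shared-endpoint p≢q centre≢b (TwoCommonNeighbours-resp F≃pq F≃cb (star-twoCommonNeighbours i≢0 j≢0 i≢j)))
      pq≃b₁b₂ : transpose p q ≃ transpose b₁ b₂
      pq≃b₁b₂ = transpose-endpoints b₁≢b₂ (meets (λ ()) i≢1 centre≢b₁ s≃) (meets (λ ()) i≢2 centre≢b₂ t≃)

  f : Fin N → Fin N
  f 0F = Wedge.centre star-wedge
  f (suc i) = proj₁ (star-leaf star-wedge {suc i} (λ ()))

  star : {i : Fin N} → i ≢ 0F → F (transpose 0F i) ≃ transpose (f 0F) (f i)
  star {0F} i≢0 = contradiction refl i≢0
  star {suc i} _ = proj₂ (proj₂ (star-leaf star-wedge {suc i} (λ ())))

  f-injective : Injective _≡_ _≡_ f
  f-injective {0F} {0F} _ = refl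
  f-injective {0F} {suc y} c≡b = contradiction (sym c≡b) (proj₁ (proj₂ (star-leaf star-wedge {suc y} (λ ()))))
  f-injective {suc x} {0F} b≡c = contradiction b≡c (proj₁ (proj₂ (star-leaf star-wedge {suc x} (λ ()))))
  f-injective {suc x} {suc y} fx≡fy = star-injective (F-injective
    (≃-trans (star {suc x} (λ ()))
             (≃-trans (≡⇒≃ (cong (transpose (f 0F)) fx≡fy)) (≃-sym (star {suc y} (λ ()))))))

  f-≢ : {x y : Fin N} → x ≢ y → f x ≢ f y
  f-≢ x≢y fx≡fy = x≢y (f-injective fx≡fy)

  opaque
    star-cycle-image : F (cycle 0F 1F 2F) ≃ cycle (f 0F) (f 1F) (f 2F) ⊎
                       F (cycle 0F 1F 2F) ≃ cycle (f 0F) (f 2F) (f 1F)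
    star-cycle-image =
      sharing-commonNeighbour (f-≢ {0F} {1F} (λ ())) (f-≢ {1F} {2F} (λ ())) (f-≢ {0F} {2F} (λ ()))
      (Adjacent-resp ≃-refl (star {1F} (λ ())) (F-adjacent (cycle-adjacent-uv (λ ()) (λ ()) (λ ()))))
      (Adjacent-resp ≃-refl (star {2F} (λ ())) (F-adjacent (cycle-adjacent-uw (λ ()) (λ ()) (λ ()))))
      (F-≄ε (cycle≄ε (λ ()) (λ ())))

  orientation : Fin 2
  orientation = side star-cycle-image

cycle-cong : {u u′ v v′ w w′ : Fin n} → u ≡ u′ → v ≡ v′ → w ≡ w′ → cycle u v w ≃ cycle u′ v′ w′
cycle-cong refl refl refl = ≃-refl

module _ {k : ℕ} {φ ψ : Aut (3 + k)}
         (Fφε≃ε : Automorphism.F φ ε ≃ ε) (Fψε≃ε : Automorphism.F ψ ε ≃ ε) where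

  private
    module Φ = Automorphism φ
    module Ψ = Automorphism ψ
    module SΦ = Stabiliser {φ = φ} Fφε≃ε
    module SΨ = Stabiliser {φ = ψ} Fψε≃ε

  same-cycle-image : (∀ x → SΦ.f x ≡ SΨ.f x) → SΦ.orientation ≡ SΨ.orientation →
                     Φ.F (cycle 0F 1F 2F) ≃ Ψ.F (cycle 0F 1F 2F)
  same-cycle-image f≗ same-orientation =
    [ (λ (Φc≃ , Ψc≃) → ≃-trans Φc≃ (≃-trans (cycle-cong (f≗ 0F) (f≗ 1F) (f≗ 2F)) (≃-sym Ψc≃)))
    , (λ (Φc≃ , Ψc≃) → ≃-trans Φc≃ (≃-trans (cycle-cong (f≗ 0F) (f≗ 2F) (f≗ 1F)) (≃-sym Ψc≃))) ]′
    (same-side SΦ.star-cycle-image SΨ.star-cycle-image same-orientation)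

  stabilisers-equal : (∀ x → SΦ.f x ≡ SΨ.f x) → SΦ.orientation ≡ SΨ.orientation → ∀ σ → Φ.F σ ≃ Ψ.F σ
  stabilisers-equal f≗ same-orientation σ =
    ≃-trans (≃-sym (Ψ.F∘G (Φ.F σ))) (Ψ.F-cong (anchored⇒identity anchored σ))
    where
    χ = Aut-inverse ψ ∘ᴬ φ
    χε≃ε : Automorphism.F χ ε ≃ ε
    χε≃ε = ≃-trans (Ψ.G-cong Fφε≃ε) (≃-trans (Ψ.G-cong (≃-sym Fψε≃ε)) (Ψ.G∘F ε))
    fixed-star : {i : Fin (3 + k)} → i ≢ 0F → Automorphism.F χ (transpose 0F i) ≃ transpose 0F i
    fixed-star {i} i≢0 = begin
      Ψ.G (Φ.F (transpose 0F i))                ≈⟨ Ψ.G-cong (SΦ.star i≢0) ⟩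
      Ψ.G (transpose (SΦ.f 0F) (SΦ.f i))        ≈⟨ Ψ.G-cong (≡⇒≃ (cong₂ transpose (f≗ 0F) (f≗ i))) ⟩
      Ψ.G (transpose (SΨ.f 0F) (SΨ.f i))        ≈⟨ Ψ.G-cong (SΨ.star i≢0) ⟨
      Ψ.G (Ψ.F (transpose 0F i))                ≈⟨ Ψ.G∘F (transpose 0F i) ⟩
      transpose 0F i                            ∎
    anchored : Anchored χ
    anchored = record
      { fixes-ε = χε≃ε
      ; fixes-transpositions = Stabiliser.fixed-star⇒fixesTranspositions {φ = χ} χε≃ε fixed-star
      ; anchor = record
        { u≢v = λ () ; v≢w = λ () ; u≢w = λ ()
        ; fixed = ≃-trans (Ψ.G-cong (same-cycle-image f≗ same-orientation)) (Ψ.G∘F (cycle 0F 1F 2F)) }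
      }

-- The bound

module _ {k : ℕ} where

  private
    N = 3 + k

  normalise : Aut N → Aut N
  normalise φ = right-translation (Automorphism.F φ ε ⁻¹) ∘ᴬ φ

  normalise-fixes-ε : (φ : Aut N) → Automorphism.F (normalise φ) ε ≃ ε
  normalise-fixes-ε φ = inverseʳ (Automorphism.F φ ε)

  module Key (φ : Aut N) where

    open Automorphism φ
    open Stabiliser {φ = normalise φ} (normalise-fixes-ε φ) public using (f; f-injective; orientation)

    Fε-injective : Injective _≡_ _≡_ (F ε ⟨$⟩ʳ_)
    Fε-injective eq = trans (sym (Perm.inverseˡ (F ε))) (trans (cong (F ε ⟨$⟩ˡ_) eq) (Perm.inverseˡ (F ε)))

    ε-code star-code : Fin (N !)
    ε-code = lehmerCode (F ε ⟨$⟩ʳ_) Fε-injective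
    star-code = lehmerCode f f-injective

    key : Fin (2 * (N !) ^ 2)
    key = combine₃ orientation ε-code star-code

  normalise-determines : {φ ψ : Aut N} → Automorphism.F φ ε ≃ Automorphism.F ψ ε →
                         (∀ σ → Automorphism.F (normalise φ) σ ≃ Automorphism.F (normalise ψ) σ) → φ ≈ᴬ ψ
  normalise-determines {φ} {ψ} same-ε-image same-normalised σ =
    at (∙-cancelʳ (Ψ.F ε ⁻¹) (Φ.F σ) (Ψ.F σ) (begin
      Φ.F σ · (Ψ.F ε ⁻¹)     ≈⟨ ·-congˡ (Φ.F σ) (⁻¹-cong same-ε-image) ⟨
      Φ.F σ · (Φ.F ε ⁻¹)     ≈⟨ same-normalised σ ⟩
      Ψ.F σ · (Ψ.F ε ⁻¹)     ∎))
    where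
    module Φ = Automorphism φ
    module Ψ = Automorphism ψ

  key-complete : (φ ψ : Aut N) → Key.key φ ≡ Key.key ψ → φ ≈ᴬ ψ
  key-complete φ ψ same-key =
    let same-orientation , same-ε-code , same-star-code =
          combine₃-injective (Key.orientation φ) (Key.ε-code φ) (Key.star-code φ)
                             (Key.orientation ψ) (Key.ε-code ψ) (Key.star-code ψ) same-key
    in normalise-determines {φ} {ψ}
         (mk≃ (lehmerCode-injective _ _ (Key.Fε-injective φ) (Key.Fε-injective ψ) same-ε-code))
         (stabilisers-equal {φ = normalise φ} {normalise ψ} (normalise-fixes-ε φ) (normalise-fixes-ε ψ)
            (lehmerCode-injective (Key.f φ) (Key.f ψ) (Key.f-injective φ) (Key.f-injective ψ) same-star-code)
            same-orientation)

mainTheorem11 : (n : ℕ) → 3 ≤ n → (L : List (Aut n)) → Distinct L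
    → length L ≤ 2 * ((n !) ^ 2)
mainTheorem11 (suc (suc (suc k))) (s≤s (s≤s (s≤s _))) L distinct =
  distinct-length≤ Key.key key-complete L distinct
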